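{- Let $(X,T)$ be a minimal subshift satisfying $1\le p_X(n+1)-p_X(n)\le2$ for all $n$, and let $(U_n)_{n\in\mathbb N}$ be a sequence of right special factors of $X$ with $U_n$ of length $n$ and $U_n$ a suffix of $U_{n+1}$ for every $n$. Then for every strong bispecial factor $B$ of $X$ of length $n$, we have $B=U_n$. In particular, if $X$ has infinitely many strong bispecial factors, then such a sequence $(U_n)_{n\in\mathbb N}$ is unique.
   Context: $p_X(n)$ is the number of words of length $n$ in the language $\mathcal L(X)$ of $X$. For $u\in\mathcal L(X)$, $\delta^+u$ (resp. $\delta^-u$) is the number of letters $a$ with $ua\in\mathcal L(X)$ (resp. $au\in\mathcal L(X)$); $u$ is right special if $\delta^+u\ge2$, bispecial if $\delta^+u\ge2$ and $\delta^-u\ge2$. The bilateral order of a bispecial $u$ is $m(u)=\#(\mathcal L(X)\cap AuA)-\delta^+u-\delta^-u+1$ ($A$ the alphabet), and $u$ is strong bispecial if $m(u)>0$. -}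

module Defs where

open import Level using (Level; _⊔_) renaming (suc to lsuc)
open import Data.Nat using (ℕ; zero; suc; _≤_; _<_; _∸_)
open import Data.Integer as ℤ using (ℤ; +_; ∣_∣)
open import Data.Fin using (Fin)
open import Data.List using (List; []; _∷_; _++_; length)
open import Data.List.Membership.Propositional using (_∈_)
open import Data.List.Relation.Unary.Unique.Propositional using (Unique)
open import Data.Product using (Σ; ∃; ∃-syntax; _×_; _,_)
open import Relation.Binary.PropositionalEquality using (_≡_; _≢_)

-- Cardinality of a (not necessarily decidable) subset P of a type A:
-- there is a duplicate-free list enumerating exactly the elements satisfying P.
HasCard : {A : Set} → (A → Set) → ℕ → Set
HasCard {A} P c = Σ (List A) λ xs →
  length xs ≡ c × Unique xs × (∀ a → (P a → a ∈ xs) × (a ∈ xs → P a))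

Point : ℕ → Set
Point k = ℤ → Fin k

Word : ℕ → Set
Word k = List (Fin k)

shift : {k : ℕ} → Point k → Point k
shift x i = x (i ℤ.+ ℤ.1ℤ)

window : {k : ℕ} → Point k → ℤ → ℕ → Word k
window x i zero    = []
window x i (suc n) = x i ∷ window x (i ℤ.+ ℤ.1ℤ) n

-- A subshift: a nonempty closed (product topology) T-invariant subset of A^ℤ.
record IsSubshift {k : ℕ} (X : Point k → Set) : Set where
  field
    nonempty  : ∃[ x ] X x
    invariant : ∀ x → X x → X (shift x)
    invariant⁻ : ∀ x → X (shift x) → X x
    closed    : ∀ x → (∀ n → ∃[ y ] (X y × (∀ i → ∣ i ∣ ≤ n → y i ≡ x i))) → X x

IsMinimalSubshift : {k : ℕ} → (Point k → Set) → Set₁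
IsMinimalSubshift {k} X =
  IsSubshift X ×
  ((Y : Point k → Set) → IsSubshift Y → (∀ x → Y x → X x) → ∀ x → X x → Y x)

InLang : {k : ℕ} → (Point k → Set) → Word k → Set
InLang X w = ∃[ x ] ∃[ i ] (X x × window x i (length w) ≡ w)

Complexity : {k : ℕ} → (Point k → Set) → ℕ → ℕ → Set
Complexity X n c = HasCard (λ w → length w ≡ n × InLang X w) c

RightValence : {k : ℕ} → (Point k → Set) → Word k → ℕ → Set
RightValence X u c = HasCard (λ a → InLang X (u ++ a ∷ [])) c

LeftValence : {k : ℕ} → (Point k → Set) → Word k → ℕ → Set
LeftValence X u c = HasCard (λ a → InLang X (a ∷ u)) c

BiExtCount : {k : ℕ} → (Point k → Set) → Word k → ℕ → Set
BiExtCount X u c =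
  HasCard (λ w → InLang X w × ∃[ a ] ∃[ b ] (w ≡ a ∷ (u ++ b ∷ []))) c

RightSpecial : {k : ℕ} → (Point k → Set) → Word k → Set
RightSpecial X u = InLang X u × ∃[ d ] (RightValence X u d × 2 ≤ d)

Bispecial : {k : ℕ} → (Point k → Set) → Word k → Set
Bispecial X u = InLang X u ×
  ∃[ d⁺ ] ∃[ d⁻ ] (RightValence X u d⁺ × LeftValence X u d⁻ × 2 ≤ d⁺ × 2 ≤ d⁻)

BilateralOrder : {k : ℕ} → (Point k → Set) → Word k → ℤ → Set
BilateralOrder X u m = ∃[ e ] ∃[ d⁺ ] ∃[ d⁻ ]
  (BiExtCount X u e × RightValence X u d⁺ × LeftValence X u d⁻ ×
   m ≡ (+ e) ℤ.- (+ d⁺) ℤ.- (+ d⁻) ℤ.+ ℤ.1ℤ)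

StrongBispecial : {k : ℕ} → (Point k → Set) → Word k → Set
StrongBispecial X u = Bispecial X u × ∃[ m ] (BilateralOrder X u m × ℤ.0ℤ ℤ.< m)

IsSuffix : {k : ℕ} → Word k → Word k → Set
IsSuffix u v = ∃[ w ] (w ++ u ≡ v)

IsRSSequence : {k : ℕ} → (Point k → Set) → (ℕ → Word k) → Set
IsRSSequence X U = ∀ n → RightSpecial X (U n) × length (U n) ≡ n × IsSuffix (U n) (U (suc n))

InfinitelyManyStrongBispecial : {k : ℕ} → (Point k → Set) → Set
InfinitelyManyStrongBispecial X = ∀ N → ∃[ B ] (N ≤ length B × StrongBispecial X B)

-- Let B be strong bispecial of length n with B ≠ Uₙ. Then B is not a suffix of Uₙ₊₁, so the
-- words aBb (at least δ⁺B + δ⁻B of them, as m(B) > 0) and Uₙ₊₁b (at least 2) are distinct words of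
-- length n + 2, all extending one of the δ⁻B + 1 words aB, Uₙ₊₁. Every other word of length n + 1
-- has some right extension, so p(n+2) − p(n+1) ≥ δ⁺B + 2 − 1 ≥ 3, contradicting the hypothesis.
-- For uniqueness, Uₙ and Vₙ are both the length-n suffix of one long strong bispecial factor.
module Submission where

open import Defs
open import Data.Nat using (ℕ; suc; _≤_; _∸_)
open import Data.List using (length)
open import Data.Product using (_×_)
open import Relation.Binary.PropositionalEquality using (_≡_)

open import Data.Nat using (zero; _+_; _≤′_; ≤′-refl; ≤′-step; z≤n; s≤s)
open import Data.Nat.Properties
  using (≤-reflexive; ≤-trans; ≤-antisym; ≤⇒≤′; <⇒≱; m<1+n⇒m≤n; m≢1+n+m; m+n≤o⇒m≤o∸n;
         +-suc; +-comm; +-assoc; +-mono-≤; +-monoˡ-≤; +-monoʳ-≤; +-cancelʳ-≤; module ≤-Reasoning)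
open import Data.Nat.Tactic.RingSolver using () renaming (solve-∀ to ℕ-solve-∀)
open import Data.Integer as ℤ using (ℤ; +_; 0ℤ; 1ℤ)
import Data.Integer.Properties as ℤ
open import Data.Integer.Tactic.RingSolver using () renaming (solve-∀ to ℤ-solve-∀)
open import Data.Fin using (Fin)
import Data.Fin.Properties as Fin
open import Data.List using (List; []; _∷_; _++_; _∷ʳ_; map; filter)
open import Data.List.Properties using (length-++; length-++-sucʳ; length-map; ++-assoc; ≡-dec; ∷-injectiveˡ; ∷-injectiveʳ; ∷ʳ-injectiveˡ; ∷ʳ-injectiveʳ)
open import Data.List.Membership.Propositional using (_∈_; _∉_)
open import Data.List.Membership.Propositional.Properties
  using (∈-∃++; ∈-++⁻; ∈-++⁺ˡ; ∈-++⁺ʳ; ∈-map⁺; ∈-map⁻; ∈-filter⁻)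
open import Data.List.Relation.Binary.Subset.Propositional using (_⊆_)
open import Data.List.Relation.Unary.Any using (here; there)
open import Data.List.Relation.Unary.All using (tabulate; lookup)
open import Data.List.Relation.Unary.AllPairs using ([]; _∷_)
open import Data.List.Relation.Unary.Unique.Propositional using (Unique)
import Data.List.Relation.Unary.Unique.Propositional.Properties as Unique
open import Data.Product using (Σ; ∃₂; _,_; proj₁; proj₂)
open import Data.Sum using (inj₁; inj₂)
open import Data.Empty using (⊥-elim)
open import Function using (_∘_)
open import Relation.Nullary using (¬_; yes; no; contradiction)
open import Level using (Level)
open import Relation.Unary using (Pred; Decidable)
open import Relation.Unary.Properties using (∁?)
open import Relation.Binary.PropositionalEquality using (refl; sym; trans; cong; subst; _≢_)

module _ {A : Set} where

  length-∷ʳ : (xs : List A) (x : A) → length (xs ∷ʳ x) ≡ suc (length xs)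
  length-∷ʳ []       x = refl
  length-∷ʳ (_ ∷ xs) x = cong suc (length-∷ʳ xs x)

  ∈-++-∷-remove : (ys : List A) {zs : List A} {x y : A} → y ∈ ys ++ x ∷ zs → y ≢ x → y ∈ ys ++ zs
  ∈-++-∷-remove ys y∈ y≢x with ∈-++⁻ ys y∈
  ... | inj₁ y∈ys         = ∈-++⁺ˡ y∈ys
  ... | inj₂ (here y≡x)   = contradiction y≡x y≢x
  ... | inj₂ (there y∈zs) = ∈-++⁺ʳ ys y∈zs

  Unique⇒length-mono-⊆ : {xs ys : List A} → Unique xs → xs ⊆ ys → length xs ≤ length ys
  Unique⇒length-mono-⊆ {[]}     _          _   = z≤n
  Unique⇒length-mono-⊆ {x ∷ xs} (x∉ ∷ uxs) xs⊆ys with ∈-∃++ (xs⊆ys (here refl))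
  ... | ys₁ , ys₂ , refl =
    ≤-trans (s≤s (Unique⇒length-mono-⊆ uxs xs⊆ys₁++ys₂)) (≤-reflexive (sym (length-++-sucʳ ys₁ x ys₂)))
    where
    xs⊆ys₁++ys₂ : xs ⊆ ys₁ ++ ys₂
    xs⊆ys₁++ys₂ y∈xs = ∈-++-∷-remove ys₁ (xs⊆ys (there y∈xs)) (λ y≡x → lookup x∉ y∈xs (sym y≡x))

  ++-cancelˡ-by-length : (ws vs : List A) {as bs : List A} →
    ws ++ as ≡ vs ++ bs → length as ≡ length bs → as ≡ bs
  ++-cancelˡ-by-length []       []       eq _ = eq
  ++-cancelˡ-by-length []       (c ∷ vs) {as} {bs} eq as≈bs =
    ⊥-elim (m≢1+n+m (length bs) (trans (sym as≈bs) (trans (cong length eq) (cong suc (length-++ vs)))))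
  ++-cancelˡ-by-length (c ∷ ws) []       {as} {bs} eq as≈bs =
    ⊥-elim (m≢1+n+m (length as) (trans as≈bs (trans (cong length (sym eq)) (cong suc (length-++ ws)))))
  ++-cancelˡ-by-length (c ∷ ws) (d ∷ vs) eq as≈bs =
    ++-cancelˡ-by-length ws vs (∷-injectiveʳ eq) as≈bs

  length-filter-∁ : {ℓ : Level} {P : Pred A ℓ} (P? : Decidable P) (xs : List A) →
    length (filter P? xs) + length (filter (∁? P?) xs) ≡ length xs
  length-filter-∁ P? []       = refl
  length-filter-∁ P? (x ∷ xs) with P? x
  ... | yes _ = cong suc (length-filter-∁ P? xs)
  ... | no  _ = trans (+-suc _ _) (cong suc (length-filter-∁ P? xs))

0<bilateralOrder⇒ : (e d⁺ d⁻ : ℕ) → 0ℤ ℤ.< + e ℤ.- + d⁺ ℤ.- + d⁻ ℤ.+ 1ℤ → d⁺ + d⁻ ≤ e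
0<bilateralOrder⇒ e d⁺ d⁻ 0<m = m<1+n⇒m≤n (ℤ.drop‿+<+ (begin-strict
  + (d⁺ + d⁻)                                        ≡⟨ sym (ℤ.+-identityʳ _) ⟩
  + (d⁺ + d⁻) ℤ.+ 0ℤ                                 <⟨ ℤ.+-monoʳ-< (+ (d⁺ + d⁻)) 0<m ⟩
  + (d⁺ + d⁻) ℤ.+ (+ e ℤ.- + d⁺ ℤ.- + d⁻ ℤ.+ 1ℤ)     ≡⟨ cong (ℤ._+ (+ e ℤ.- + d⁺ ℤ.- + d⁻ ℤ.+ 1ℤ)) (ℤ.pos-+ d⁺ d⁻) ⟩
  + d⁺ ℤ.+ + d⁻ ℤ.+ (+ e ℤ.- + d⁺ ℤ.- + d⁻ ℤ.+ 1ℤ)   ≡⟨ cancel (+ e) (+ d⁺) (+ d⁻) ⟩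
  + e ℤ.+ 1ℤ                                         ≡⟨ ℤ.pos-+ e 1 ⟩
  + (e + 1)                                          ≡⟨ cong +_ (+-comm e 1) ⟩
  + suc e                                            ∎))
  where
  open ℤ.≤-Reasoning
  cancel : ∀ a b c → b ℤ.+ c ℤ.+ (a ℤ.- b ℤ.- c ℤ.+ 1ℤ) ≡ a ℤ.+ 1ℤ
  cancel = ℤ-solve-∀

HasCard-functional : {A : Set} {P : A → Set} {c d : ℕ} → HasCard P c → HasCard P d → c ≡ d
HasCard-functional (xs , refl , uxs , xs-spec) (ys , refl , uys , ys-spec) =
  ≤-antisym (Unique⇒length-mono-⊆ uxs (λ {a} → proj₁ (ys-spec a) ∘ proj₂ (xs-spec a)))
            (Unique⇒length-mono-⊆ uys (λ {a} → proj₁ (xs-spec a) ∘ proj₂ (ys-spec a)))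

module _ {k : ℕ} where

  open import Data.List.Membership.DecPropositional (≡-dec (Fin._≟_ {k})) using (_∈?_)

  _∖_ : List (Word k) → List (Word k) → List (Word k)
  ℓ ∖ P = filter (∁? (_∈? P)) ℓ

  ∈-∖⁻ : {u : Word k} (ℓ P : List (Word k)) → u ∈ ℓ ∖ P → u ∈ ℓ × u ∉ P
  ∈-∖⁻ ℓ P = ∈-filter⁻ (∁? (_∈? P)) {xs = ℓ}

  IsSuffix-trans : {u v w : Word k} → IsSuffix u v → IsSuffix v w → IsSuffix u w
  IsSuffix-trans (s , refl) (t , refl) = t ++ s , ++-assoc t s _

  IsSuffix-unique : {u v w : Word k} → IsSuffix u w → IsSuffix v w → length u ≡ length v → u ≡ v
  IsSuffix-unique (s , refl) (t , eq) = ++-cancelˡ-by-length s t (sym eq)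

  window-suc : (x : Point k) (i : ℤ) (n : ℕ) → Σ (Fin k) λ a → window x i (suc n) ≡ window x i n ∷ʳ a
  window-suc x i zero    = x i , refl
  window-suc x i (suc n) with window-suc x (i ℤ.+ 1ℤ) n
  ... | a , eq = a , cong (x i ∷_) eq

  window-++⁻ˡ : (x : Point k) (i : ℤ) (u v : Word k) → window x i (length (u ++ v)) ≡ u ++ v →
    window x i (length u) ≡ u
  window-++⁻ˡ x i []      v eq = refl
  window-++⁻ˡ x i (a ∷ u) v eq with refl ← ∷-injectiveˡ eq =
    cong (a ∷_) (window-++⁻ˡ x (i ℤ.+ 1ℤ) u v (∷-injectiveʳ eq))

  module _ {X : Point k → Set} where

    InLang-++⁻ˡ : (u v : Word k) → InLang X (u ++ v) → InLang X u
    InLang-++⁻ˡ u v (x , i , Xx , eq) = x , i , Xx , window-++⁻ˡ x i u v eq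

    InLang-∷ʳ : {u : Word k} → InLang X u → Σ (Fin k) λ a → InLang X (u ∷ʳ a)
    InLang-∷ʳ {u} (x , i , Xx , eq) with window-suc x i (length u)
    ... | a , eq′ = a , x , i , Xx ,
      trans (cong (window x i) (length-∷ʳ u a)) (trans eq′ (cong (_∷ʳ a) eq))

module _ {k : ℕ} (X : Point k → Set) where

  open import Data.List.Membership.DecPropositional (≡-dec (Fin._≟_ {k})) using (_∈?_)

  choose-right-extensions : (us : List (Word k)) → Unique us → (∀ {u} → u ∈ us → InLang X u) →
    Σ (List (Word k)) λ vs → length vs ≡ length us × Unique vs ×
      (∀ {v} → v ∈ vs → InLang X v × ∃₂ λ u a → u ∈ us × v ≡ u ∷ʳ a)
  choose-right-extensions []       []          _   = [] , refl , [] , λ ()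
  choose-right-extensions (u ∷ us) (u∉ ∷ uus) inL
    with InLang-∷ʳ (inL (here refl)) | choose-right-extensions us uus (inL ∘ there)
  ... | a , ua∈L | vs , |vs| , uvs , vs-spec =
    u ∷ʳ a ∷ vs , cong suc |vs| , tabulate ua∉vs ∷ uvs ,
    λ { (here refl) → ua∈L , u , a , here refl , refl
      ; (there v∈)  → let (v∈L , u′ , a′ , u′∈ , eq) = vs-spec v∈ in v∈L , u′ , a′ , there u′∈ , eq }
    where
    ua∉vs : ∀ {v} → v ∈ vs → u ∷ʳ a ≢ v
    ua∉vs v∈ eq with vs-spec v∈
    ... | _ , u′ , a′ , u′∈ , refl = lookup u∉ u′∈ (∷ʳ-injectiveˡ u u′ eq)

  -- Each word of length N outside P has a chosen extension, and these avoid Ws.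
  complexity-step-bound : {N c c′ : ℕ} → Complexity X N c → Complexity X (suc N) c′ →
    (P Ws : List (Word k)) → Unique Ws →
    (∀ {w} → w ∈ Ws → InLang X w × length w ≡ suc N × ∃₂ λ u b → u ∈ P × w ≡ u ∷ʳ b) →
    c + length Ws ≤ c′ + length P
  complexity-step-bound {N} {c} {c′} (ℓ , refl , uℓ , ℓ-spec) (ℓ′ , refl , uℓ′ , ℓ′-spec) P Ws uWs Ws-spec
    with choose-right-extensions (ℓ ∖ P) (Unique.filter⁺ (∁? (_∈? P)) uℓ)
           (λ u∈ → proj₂ (proj₂ (ℓ-spec _) (proj₁ (∈-∖⁻ ℓ P u∈))))
  ... | E , |E| , uE , E-spec = begin
    length ℓ + length Ws                                ≡⟨ cong (_+ length Ws) (sym (length-filter-∁ (_∈? P) ℓ)) ⟩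
    length ℓ∩P + length (ℓ ∖ P) + length Ws         ≤⟨ +-monoˡ-≤ (length Ws) (+-mono-≤ ℓ∩P≤P (≤-reflexive (sym |E|))) ⟩
    length P + length E + length Ws                      ≡⟨ trans (+-assoc (length P) _ _) (cong (_+_ (length P)) (sym (length-++ E))) ⟩
    length P + length (E ++ Ws)                          ≤⟨ +-monoʳ-≤ (length P) (Unique⇒length-mono-⊆ (Unique.++⁺ uE uWs E∩Ws≡∅) E++Ws⊆ℓ′) ⟩
    length P + length ℓ′                                 ≡⟨ +-comm (length P) _ ⟩
    length ℓ′ + length P                                 ∎
    where
    open ≤-Reasoning
    ℓ∩P : List (Word k)
    ℓ∩P = filter (_∈? P) ℓ
    ℓ∩P≤P : length ℓ∩P ≤ length P
    ℓ∩P≤P = Unique⇒length-mono-⊆ (Unique.filter⁺ (_∈? P) uℓ) (proj₂ ∘ ∈-filter⁻ (_∈? P) {xs = ℓ})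
    E∩Ws≡∅ : ∀ {v} → ¬ (v ∈ E × v ∈ Ws)
    E∩Ws≡∅ (v∈E , v∈Ws) with E-spec v∈E | Ws-spec v∈Ws
    ... | _ , u , a , u∈ , refl | _ , _ , u′ , b , u′∈P , eq =
      proj₂ (∈-∖⁻ ℓ P u∈) (subst (_∈ P) (sym (∷ʳ-injectiveˡ u u′ eq)) u′∈P)
    E++Ws⊆ℓ′ : E ++ Ws ⊆ ℓ′
    E++Ws⊆ℓ′ {w} w∈ with ∈-++⁻ E w∈
    ... | inj₂ w∈Ws = let (w∈L , |w| , _) = Ws-spec w∈Ws in proj₁ (ℓ′-spec w) (|w| , w∈L)
    ... | inj₁ w∈E with E-spec w∈E
    ... | w∈L , u , a , u∈ , refl =
      proj₁ (ℓ′-spec w) (trans (length-∷ʳ u a) (cong suc (proj₁ (proj₂ (ℓ-spec u) (proj₁ (∈-∖⁻ ℓ P u∈))))) , w∈L)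

module _ {k : ℕ} {X : Point k → Set} where

  strongBispecial-not-suffix⇒growth≥3 : {n c c′ : ℕ} {B U′ : Word k} →
    Complexity X (suc n) c → Complexity X (suc (suc n)) c′ →
    length B ≡ n → StrongBispecial X B →
    length U′ ≡ suc n → RightSpecial X U′ → ¬ IsSuffix B U′ →
    3 + c ≤ c′
  strongBispecial-not-suffix⇒growth≥3 {c = c} {c′} {B} {U′} pₙ₊₁ pₙ₊₂ refl
    ((_ , _ , _ , rv′ , _ , 2≤d⁺′ , _) ,
     _ , (_ , d⁺ , _ , (ws , refl , uws , ws-spec) , rv , (as , refl , _ , as-spec) , refl) , 0<m)
    |U′| (_ , _ , (bs , refl , ubs , bs-spec) , 2≤d) B⋢U′ =
    +-cancelʳ-≤ (suc (length as)) (3 + c) c′ (begin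
      3 + c + suc (length as)                ≡⟨ rearrange c (length as) ⟩
      c + (2 + length as + 2)                ≤⟨ +-monoʳ-≤ c (+-mono-≤ 2+|as|≤|ws| 2≤d) ⟩
      c + (length ws + length bs)            ≡⟨ cong (_+_ c) (sym |Ws|) ⟩
      c + length Ws                          ≤⟨ complexity-step-bound X pₙ₊₁ pₙ₊₂ P Ws uWs Ws-spec ⟩
      c′ + length P                          ≡⟨ cong (λ l → c′ + suc l) (length-map (_∷ B) as) ⟩
      c′ + suc (length as)                   ∎)
    where
    open ≤-Reasoning
    rearrange : ∀ c d → 3 + c + suc d ≡ c + (2 + d + 2)
    rearrange = ℕ-solve-∀
    2+|as|≤|ws| : 2 + length as ≤ length ws
    2+|as|≤|ws| = ≤-trans (+-monoˡ-≤ (length as) (subst (2 ≤_) (HasCard-functional rv′ rv) 2≤d⁺′))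
                     (0<bilateralOrder⇒ (length ws) d⁺ (length as) 0<m)
    P Ws : List (Word k)
    P  = U′ ∷ map (_∷ B) as
    Ws = ws ++ map (U′ ∷ʳ_) bs
    |Ws| : length Ws ≡ length ws + length bs
    |Ws| = trans (length-++ ws) (cong (_+_ (length ws)) (length-map (U′ ∷ʳ_) bs))
    ws∩extU′≡∅ : ∀ {v} → ¬ (v ∈ ws × v ∈ map (U′ ∷ʳ_) bs)
    ws∩extU′≡∅ {v} (v∈ws , v∈ext) with proj₂ (ws-spec v) v∈ws | ∈-map⁻ (U′ ∷ʳ_) v∈ext
    ... | _ , a , b , refl | _ , _ , eq = B⋢U′ (a ∷ [] , ∷ʳ-injectiveˡ (a ∷ B) U′ eq)
    uWs : Unique Ws
    uWs = Unique.++⁺ uws (Unique.map⁺ (∷ʳ-injectiveʳ U′ U′) ubs) ws∩extU′≡∅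
    Ws-spec : ∀ {w} → w ∈ Ws →
      InLang X w × length w ≡ suc (suc (length B)) × ∃₂ λ u b → u ∈ P × w ≡ u ∷ʳ b
    Ws-spec {w} w∈ with ∈-++⁻ ws w∈
    ... | inj₁ w∈ws with proj₂ (ws-spec w) w∈ws
    ...   | w∈L , a , b , refl =
      w∈L , cong suc (length-∷ʳ B b) , a ∷ B , b ,
      there (∈-map⁺ (_∷ B) (proj₁ (as-spec a) (InLang-++⁻ˡ (a ∷ B) (b ∷ []) w∈L))) , refl
    Ws-spec {w} w∈ | inj₂ w∈ext with ∈-map⁻ (U′ ∷ʳ_) w∈ext
    ...   | b , b∈bs , refl =
      proj₂ (bs-spec b) b∈bs , trans (length-∷ʳ U′ b) (cong suc |U′|) , U′ , b , here refl , refl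

  IsRSSequence-suffix : {U : ℕ → Word k} → IsRSSequence X U → {m n : ℕ} → m ≤ n → IsSuffix (U m) (U n)
  IsRSSequence-suffix {U} U-rs {m} = go ∘ ≤⇒≤′
    where
    go : ∀ {n} → m ≤′ n → IsSuffix (U m) (U n)
    go ≤′-refl        = [] , refl
    go (≤′-step m≤′n) = IsSuffix-trans (go m≤′n) (proj₂ (proj₂ (U-rs _)))

  module _ {p : ℕ → ℕ} (p-spec : ∀ n → Complexity X n (p n)) (growth≤2 : ∀ n → p (suc n) ∸ p n ≤ 2) where

    StrongBispecial⇒≡RSSequence : {U : ℕ → Word k} → IsRSSequence X U →
      (n : ℕ) (B : Word k) → length B ≡ n → StrongBispecial X B → B ≡ U n
    StrongBispecial⇒≡RSSequence {U} U-rs n B |B| sb with ≡-dec Fin._≟_ B (U n)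
    ... | yes B≡Uₙ = B≡Uₙ
    ... | no  B≢Uₙ = contradiction
      (m+n≤o⇒m≤o∸n 3 (strongBispecial-not-suffix⇒growth≥3 (p-spec (suc n)) (p-spec (suc (suc n)))
                         |B| sb (proj₁ (proj₂ (U-rs (suc n)))) (proj₁ (U-rs (suc n))) B⋢Uₙ₊₁))
      (<⇒≱ (s≤s (growth≤2 (suc n))))
      where
      B⋢Uₙ₊₁ : ¬ IsSuffix B (U (suc n))
      B⋢Uₙ₊₁ B⊑Uₙ₊₁ =
        B≢Uₙ (IsSuffix-unique B⊑Uₙ₊₁ (proj₂ (proj₂ (U-rs n))) (trans |B| (sym (proj₁ (proj₂ (U-rs n))))))

    RSSequence-unique : InfinitelyManyStrongBispecial X → {U V : ℕ → Word k} →
      IsRSSequence X U → IsRSSequence X V → ∀ n → V n ≡ U n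
    RSSequence-unique infinite {U} {V} U-rs V-rs n with infinite n
    ... | B , n≤|B| , sb =
      IsSuffix-unique
        (subst (IsSuffix (V n)) Vₘ≡Uₘ (IsRSSequence-suffix V-rs n≤|B|))
        (IsRSSequence-suffix U-rs n≤|B|)
        (trans (proj₁ (proj₂ (V-rs n))) (sym (proj₁ (proj₂ (U-rs n)))))
      where
      Vₘ≡Uₘ : V (length B) ≡ U (length B)
      Vₘ≡Uₘ = trans (sym (StrongBispecial⇒≡RSSequence V-rs _ B refl sb))
                    (StrongBispecial⇒≡RSSequence U-rs _ B refl sb)

corollary4p4 : (k : ℕ) (X : Point k → Set) → IsMinimalSubshift X →
    (p : ℕ → ℕ) → (∀ n → Complexity X n (p n)) →
    (∀ n → 1 ≤ p (suc n) ∸ p n × p (suc n) ∸ p n ≤ 2) →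
    (U : ℕ → Word k) → IsRSSequence X U →
    ((n : ℕ) (B : Word k) → length B ≡ n → StrongBispecial X B → B ≡ U n)
    × (InfinitelyManyStrongBispecial X →
       (V : ℕ → Word k) → IsRSSequence X V → ∀ n → V n ≡ U n)
corollary4p4 k X _ p p-spec growth U U-rs =
  StrongBispecial⇒≡RSSequence p-spec growth≤2 U-rs ,
  λ infinite V V-rs → RSSequence-unique p-spec growth≤2 infinite U-rs V-rs
  where
  growth≤2 : ∀ n → p (suc n) ∸ p n ≤ 2
  growth≤2 = proj₂ ∘ growth
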